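{- For every finite simple graph $G$ with $\Delta(G)\geq 2$ we have $A_b(G)\leq \frac{1}{2}(\Delta(G))^2+1$.
   Context: $\Delta(G)$ denotes the maximum degree of $G$. A (proper) $k$-coloring of $G$ is a map $c:V(G)\to[k]$ with adjacent vertices colored differently, all $k$ colors used; $V_i=c^{ -1}(i)$. A coloring is acyclic if $G[V_i\cup V_j]$ is a forest for all $i,j$. A vertex $v$ is a b-vertex if the colors on $v$ and its neighbors are all $k$ colors. A recoloring step applied to $c$ and a color $i$ having no b-vertex recolors every $v\in V_i$ with a color not appearing on $v$ or its neighbors, producing a $(k-1)$-coloring; if both colorings are acyclic it is an acyclic recoloring step. The acyclic b-chromatic number $A_b(G)$ is the maximum number of colors of an acyclic coloring of $G$ to which no acyclic recoloring step can be applied. -}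

module Defs where

open import Data.Nat using (ℕ; zero; suc; _+_; _≤_; _⊔_)
open import Data.Fin using (Fin; zero; suc; inject₁; fromℕ)
open import Data.Bool using (Bool; true; false; T)
open import Data.List using (List; length; filter; foldr; map)
open import Data.List.Base using (allFin)
open import Data.Product using (Σ; ∃; _×_; _,_)
open import Data.Sum using (_⊎_)
open import Relation.Nullary using (¬_)
open import Relation.Binary.PropositionalEquality using (_≡_; _≢_)
open import Data.Bool.Properties using (T?)
open import Function.Definitions using (Injective)

record Graph (n : ℕ) : Set where
  field
    adj    : Fin n → Fin n → Bool
    sym    : ∀ u v → adj u v ≡ adj v u
    irrefl : ∀ v → adj v v ≡ false

open Graph public

Adj : ∀ {n} → Graph n → Fin n → Fin n → Set
Adj G u v = T (adj G u v)

deg : ∀ {n} → Graph n → Fin n → ℕ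
deg {n} G v = length (filter (λ u → T? (adj G v u)) (allFin n))

Δ : ∀ {n} → Graph n → ℕ
Δ {n} G = foldr _⊔_ 0 (map (deg G) (allFin n))

Proper : ∀ {n k} → Graph n → (Fin n → Fin k) → Set
Proper G c = ∀ u v → Adj G u v → c u ≢ c v

Surjective : ∀ {n k} → (Fin n → Fin k) → Set
Surjective {n} {k} c = ∀ (a : Fin k) → ∃ λ v → c v ≡ a

IsColoring : ∀ {n k} → Graph n → (Fin n → Fin k) → Set
IsColoring G c = Proper G c × Surjective c

-- A cycle in G all of whose vertices satisfy P: distinct vertices
-- f 0, ..., f (m+2) (length m+3 ≥ 3), consecutive ones adjacent,
-- and the last adjacent to the first.
record CycleIn {n : ℕ} (G : Graph n) (P : Fin n → Set) : Set where
  field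
    len    : ℕ
    f      : Fin (suc (suc (suc len))) → Fin n
    inj    : Injective _≡_ _≡_ f
    step   : ∀ (i : Fin (suc (suc len))) → Adj G (f (inject₁ i)) (f (suc i))
    close  : Adj G (f (fromℕ (suc (suc len)))) (f zero)
    inside : ∀ i → P (f i)

InducedForest : ∀ {n} → Graph n → (Fin n → Set) → Set
InducedForest G P = ¬ CycleIn G P

Acyclic : ∀ {n k} → Graph n → (Fin n → Fin k) → Set
Acyclic {n} {k} G c = ∀ (i j : Fin k) → InducedForest G (λ v → c v ≡ i ⊎ c v ≡ j)

AppearsAt : ∀ {n k} → Graph n → (Fin n → Fin k) → Fin n → Fin k → Set
AppearsAt G c v a = c v ≡ a ⊎ ∃ λ u → Adj G v u × c u ≡ a

IsBVertex : ∀ {n k} → Graph n → (Fin n → Fin k) → Fin n → Set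
IsBVertex {k = k} G c v = ∀ (a : Fin k) → AppearsAt G c v a

-- c' is obtained from c by a recoloring step at color i:
-- color i has no b-vertex, vertices outside V_i keep their color and
-- every v ∈ V_i gets a color not appearing on v or its neighbours (under c).
-- (Colors are kept in Fin k; color i becomes unused, so c' uses k-1 colors.)
RecoloringStep : ∀ {n k} → Graph n → (Fin n → Fin k) → Fin k → (Fin n → Fin k) → Set
RecoloringStep G c i c' =
  (∀ v → ¬ (c v ≡ i × IsBVertex G c v)) ×
  (∀ v → ¬ (c v ≡ i) → c' v ≡ c v) ×
  (∀ v → c v ≡ i → ¬ AppearsAt G c v (c' v))

AcyclicRecolorable : ∀ {n k} → Graph n → (Fin n → Fin k) → Set
AcyclicRecolorable {n} {k} G c =
  Acyclic G c × ∃ λ (i : Fin k) → ∃ λ (c' : Fin n → Fin k) →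
    RecoloringStep G c i c' × Acyclic G c'

-- c is an acyclic b-coloring (a coloring witnessing A_b(G) ≥ k):
-- acyclic k-coloring to which no acyclic recoloring step applies.
-- A_b(G) is the maximum k for which such a c exists.
IsAcyclicBColoring : ∀ {n k} → Graph n → (Fin n → Fin k) → Set
IsAcyclicBColoring G c = IsColoring G c × Acyclic G c × ¬ AcyclicRecolorable G c

{-# OPTIONS --safe #-}
-- Suppose 2k > Δ² + 2 and let c be an acyclic k-colouring. Recolour the vertices of one colour
-- class one at a time, giving each vertex v a colour a that is fresh: a does not appear on v or its
-- neighbours, and a is not dangerous, i.e. there are no two distinct, equally coloured neighbours
-- u, w of v which both have a further neighbour coloured a. Fresh recolourings keep the colouring
-- proper and acyclic, since a new 2-coloured cycle through v would run x – u – v – w – y and make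
-- the new colour of v dangerous. A fresh colour exists by weighing the colours: v puts 2 on its own
-- colour, and a neighbour u of v puts 2 on its colour if no other neighbour of v shares it, and
-- otherwise 1 on its colour and 1 on the colour of each of its other neighbours. Each neighbour
-- spends at most Δ, so the total is at most Δ² + 2, while every non-fresh colour gets at least 2.
-- The same count shows that no vertex is a b-vertex, so this is an acyclic recolouring step.
module Submission where

open import Defs hiding (sym)
open import Data.Nat using (ℕ; zero; suc; _+_; _*_; _≤_; _<_; z≤n; s≤s)
open import Data.Nat.Properties
  using (+-*-semiring; ≤-refl; ≤-trans; ≤-reflexive; +-mono-≤; +-monoˡ-≤; +-monoʳ-≤; *-monoˡ-≤; *-monoʳ-≤;
         m≤m+n; m≤n+m; m≤m⊔n; m≤n⊔m; m<n+m; >⇒≢; *-comm; *-zeroʳ; *-identityˡ; *-identityʳ;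
         <⇒≱; ≰⇒>; _≤?_)
import Data.Nat.Properties as ℕ
open import Data.Fin using (Fin; zero; suc; toℕ; fromℕ; inject₁; lower₁; punchOut)
open import Data.Fin.Properties
  using (_≟_; any?; ¬∀⟶∃¬; toℕ-injective; toℕ-fromℕ; toℕ-inject₁; inject₁-lower₁; punchIn-punchOut)
open import Data.Bool using (Bool; true; false; T; not; _∧_; if_then_else_)
open import Data.Bool.Properties using (T?; ∧-identityʳ; ∧-zeroʳ)
open import Data.List using (List; []; _∷_; length; filter; foldr; map; tabulate; allFin)
open import Data.List.Properties using (foldr-preservesᵒ)
open import Data.List.Relation.Unary.Any as Any using (here; there)
open import Data.List.Relation.Unary.Any.Properties using (map⁺)
open import Data.List.Membership.Propositional using (_∈_)
open import Data.List.Membership.Propositional.Properties using (∈-allFin)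
open import Data.Vec.Functional using (updateAt; removeAt)
open import Data.Vec.Functional.Properties using (updateAt-updates; updateAt-minimal)
open import Data.Product using (∃; _×_; _,_; proj₁; proj₂)
open import Data.Sum using (_⊎_; inj₁; inj₂; [_,_])
open import Data.Empty using (⊥)
open import Function using (_∘_; const; id)
open import Relation.Nullary using (¬_; Dec; yes; no; does; contradiction)
open import Relation.Nullary.Decidable using (dec-true; dec-false; _×-dec_; _⊎-dec_; ¬?)
open import Relation.Binary.PropositionalEquality
  using (_≡_; _≢_; refl; sym; trans; cong; cong₂; subst; ≢-sym; module ≡-Reasoning)
open import Algebra.Properties.Semiring.Sum +-*-semiring
  using (sum; sum-syntax; sum-cong-≗; sum-remove; ∑-distrib-+; ∑-comm; *-distribˡ-sum; *-distribʳ-sum)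

𝟙 : Bool → ℕ
𝟙 true  = 1
𝟙 false = 0

δ : ∀ {m} → Fin m → Fin m → ℕ
δ a b = 𝟙 (does (a ≟ b))

𝟙-T : ∀ {b} → T b → 𝟙 b ≡ 1
𝟙-T {true} _ = refl

𝟙*-mono-≤ : ∀ b {x y} → (T b → x ≤ y) → 𝟙 b * x ≤ 𝟙 b * y
𝟙*-mono-≤ true  x≤y = *-monoʳ-≤ 1 (x≤y _)
𝟙*-mono-≤ false _   = z≤n

δ-≡ : ∀ {m} {a b : Fin m} → a ≡ b → δ a b ≡ 1
δ-≡ {a = a} {b} a≡b = cong 𝟙 (dec-true (a ≟ b) a≡b)

∑-const : ∀ m c → ∑[ i < m ] c ≡ m * c
∑-const zero    c = refl
∑-const (suc m) c = cong (c +_) (∑-const m c)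

∑-mono-≤ : ∀ {m} {f g : Fin m → ℕ} → (∀ i → f i ≤ g i) → sum f ≤ sum g
∑-mono-≤ {zero}  _   = z≤n
∑-mono-≤ {suc m} f≤g = +-mono-≤ (f≤g zero) (∑-mono-≤ (f≤g ∘ suc))

≤-∑ : ∀ {m} (f : Fin m → ℕ) i → f i ≤ sum f
≤-∑ {suc m} f i = ≤-trans (m≤m+n (f i) _) (≤-reflexive (sym (sum-remove {i = i} f)))

+-≤-∑ : ∀ {m} (f : Fin m → ℕ) {i j} → i ≢ j → f i + f j ≤ sum f
+-≤-∑ {suc m} f {i} {j} i≢j = begin
  f i + f j                         ≡⟨ cong (λ l → f i + f l) (punchIn-punchOut i≢j) ⟨
  f i + removeAt f i (punchOut i≢j) ≤⟨ +-monoʳ-≤ (f i) (≤-∑ (removeAt f i) _) ⟩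
  f i + sum (removeAt f i)          ≡⟨ sum-remove f ⟨
  sum f                             ∎
  where open ℕ.≤-Reasoning

∑-δ : ∀ {m} (b : Fin m) → ∑[ a < m ] δ b a ≡ 1
∑-δ {suc m} zero    = cong suc (trans (∑-const m 0) (*-zeroʳ m))
∑-δ {suc m} (suc b) = ∑-δ b

∑-fibres : ∀ {m l} (f : Fin m → ℕ) (g : Fin m → Fin l) →
           ∑[ a < l ] ∑[ x < m ] (f x * δ (g x) a) ≡ sum f
∑-fibres {m} {l} f g = begin
  ∑[ a < l ] ∑[ x < m ] (f x * δ (g x) a) ≡⟨ ∑-comm (λ a x → f x * δ (g x) a) ⟩
  ∑[ x < m ] ∑[ a < l ] (f x * δ (g x) a) ≡⟨ sum-cong-≗ (λ x → *-distribˡ-sum (f x) (δ (g x))) ⟨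
  ∑[ x < m ] (f x * ∑[ a < l ] δ (g x) a) ≡⟨ sum-cong-≗ (λ x → trans (cong (f x *_) (∑-δ (g x))) (*-identityʳ (f x))) ⟩
  sum f                                   ∎
  where open ≡-Reasoning

length-filter-tabulate : ∀ {m l} (b : Fin l → Bool) (h : Fin m → Fin l) →
                         length (filter (T? ∘ b) (tabulate h)) ≡ ∑[ i < m ] 𝟙 (b (h i))
length-filter-tabulate {zero}  b h = refl
length-filter-tabulate {suc m} b h with b (h zero)
... | true  = cong suc (length-filter-tabulate b (h ∘ suc))
... | false = length-filter-tabulate b (h ∘ suc)

module _ {n} (G : Graph n) where

  adj-sym : ∀ {u w} → Adj G u w → Adj G w u
  adj-sym {u} {w} = subst T (Graph.sym G u w)

  adj-≢ : ∀ {u w} → Adj G u w → u ≢ w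
  adj-≢ {u} u~u refl = subst T (irrefl G u) u~u

  deg≡∑ : ∀ v → deg G v ≡ ∑[ u < n ] 𝟙 (adj G v u)
  deg≡∑ v = length-filter-tabulate (adj G v) id

  deg≤Δ : ∀ v → deg G v ≤ Δ G
  deg≤Δ v = foldr-preservesᵒ {P = deg G v ≤_}
    (λ x y → [ (λ p → ≤-trans p (m≤m⊔n x y)) , (λ p → ≤-trans p (m≤n⊔m x y)) ])
    0 (map (deg G) (allFin n)) (inj₂ (map⁺ (Any.map (λ { refl → ≤-refl }) (∈-allFin v))))

module _ {n k} (G : Graph n) (q : Fin n → Fin k) where

  OtherNeighbourColoured : Fin n → Fin n → Fin k → Set
  OtherNeighbourColoured u v a = ∃ λ x → Adj G u x × x ≢ v × q x ≡ a

  Dangerous : Fin n → Fin k → Set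
  Dangerous v a = ∃ λ u → ∃ λ w → Adj G v u × Adj G v w × u ≢ w × q u ≡ q w ×
                  OtherNeighbourColoured u v a × OtherNeighbourColoured w v a

  Fresh : Fin n → Fin k → Set
  Fresh v a = ¬ AppearsAt G q v a × ¬ Dangerous v a

  appearsAt? : ∀ v a → Dec (AppearsAt G q v a)
  appearsAt? v a = (q v ≟ a) ⊎-dec any? (λ u → T? (adj G v u) ×-dec (q u ≟ a))

  dangerous? : ∀ v a → Dec (Dangerous v a)
  dangerous? v a = any? λ u → any? λ w →
    T? (adj G v u) ×-dec T? (adj G v w) ×-dec ¬? (u ≟ w) ×-dec (q u ≟ q w) ×-dec
    otherNeighbourColoured? u ×-dec otherNeighbourColoured? w
    where
    otherNeighbourColoured? : ∀ u → Dec (OtherNeighbourColoured u v a)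
    otherNeighbourColoured? u = any? λ x → T? (adj G u x) ×-dec ¬? (x ≟ v) ×-dec (q x ≟ a)

infix 4 _↝_

data _↝_ {N : ℕ} : Fin (suc N) → Fin (suc N) → Set where
  next : ∀ i → inject₁ i ↝ suc i
  wrap : fromℕ N ↝ zero

↝-successor : ∀ {N} (i : Fin (suc N)) → ∃ (i ↝_)
↝-successor {N} i with N ℕ.≟ toℕ i
... | no N≢i  = suc (lower₁ i N≢i) , subst (_↝ suc (lower₁ i N≢i)) (inject₁-lower₁ i N≢i) (next _)
... | yes N≡i = zero , subst (_↝ zero) (toℕ-injective (trans (toℕ-fromℕ N) N≡i)) wrap

↝-predecessor : ∀ {N} (j : Fin (suc N)) → ∃ (_↝ j)
↝-predecessor zero    = fromℕ _ , wrap
↝-predecessor (suc j) = inject₁ j , next j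

↝-toℕ : ∀ {N} {i j : Fin (suc N)} → i ↝ j → toℕ j ≡ suc (toℕ i) ⊎ (toℕ i ≡ N × toℕ j ≡ 0)
↝-toℕ (next i) = inj₁ (cong suc (sym (toℕ-inject₁ i)))
↝-toℕ wrap     = inj₂ (toℕ-fromℕ _ , refl)

↝²-≢ : ∀ {l} {i j h : Fin (3 + l)} → i ↝ j → j ↝ h → h ≢ i
↝²-≢ {l} i↝j j↝i refl = no-2-cycle (↝-toℕ i↝j) (↝-toℕ j↝i)
  where
  no-2-cycle : ∀ {a b} → b ≡ suc a ⊎ (a ≡ 2 + l × b ≡ 0) → a ≡ suc b ⊎ (b ≡ 2 + l × a ≡ 0) → ⊥
  no-2-cycle (inj₁ refl) (inj₁ a≡2+a)       = >⇒≢ (m<n+m _ (s≤s z≤n)) (sym a≡2+a)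
  no-2-cycle (inj₁ refl) (inj₂ (() , refl))
  no-2-cycle (inj₂ (refl , refl)) (inj₁ ())
  no-2-cycle (inj₂ (_ , refl)) (inj₂ (() , _))

-- x – u – v – w – y in G[P]; x and y may coincide.
record Arc {n} (G : Graph n) (P : Fin n → Set) (v : Fin n) : Set where
  field
    u x w y : Fin n
    v~u : Adj G v u
    u~x : Adj G u x
    v~w : Adj G v w
    w~y : Adj G w y
    u≢w : u ≢ w
    x≢v : x ≢ v
    y≢v : y ≢ v
    Pv  : P v
    Pu  : P u
    Px  : P x
    Pw  : P w
    Py  : P y

cycle-arc : ∀ {n} {G : Graph n} {P : Fin n → Set} (C : CycleIn G P) m → Arc G P (CycleIn.f C m)
cycle-arc {G = G} C m = record
  { v~u = ↝-adj m↝u ; u~x = ↝-adj u↝x ; v~w = adj-sym G (↝-adj w↝m) ; w~y = adj-sym G (↝-adj y↝w)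
  ; u≢w = ↝²-≢ w↝m m↝u ∘ inj ; x≢v = ↝²-≢ m↝u u↝x ∘ inj ; y≢v = ≢-sym (↝²-≢ y↝w w↝m ∘ inj)
  ; Pv = inside m ; Pu = inside u ; Px = inside x ; Pw = inside w ; Py = inside y }
  where
  open CycleIn C
  ↝-adj : ∀ {i j} → i ↝ j → Adj G (f i) (f j)
  ↝-adj (next i) = step i
  ↝-adj wrap     = close
  u = proj₁ (↝-successor m)
  m↝u = proj₂ (↝-successor m)
  x = proj₁ (↝-successor u)
  u↝x = proj₂ (↝-successor u)
  w = proj₁ (↝-predecessor m)
  w↝m = proj₂ (↝-predecessor m)
  y = proj₁ (↝-predecessor w)
  y↝w = proj₂ (↝-predecessor w)

other-of-two : ∀ {A : Set} {a b x y z : A} → x ≡ a ⊎ x ≡ b → y ≡ a ⊎ y ≡ b → z ≡ a ⊎ z ≡ b →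
               x ≢ y → x ≢ z → y ≡ z
other-of-two (inj₁ refl) (inj₁ refl) _           x≢y _   = contradiction refl x≢y
other-of-two (inj₁ refl) (inj₂ refl) (inj₁ refl) _   x≢z = contradiction refl x≢z
other-of-two (inj₁ refl) (inj₂ refl) (inj₂ refl) _   _   = refl
other-of-two (inj₂ refl) (inj₁ refl) (inj₁ refl) _   _   = refl
other-of-two (inj₂ refl) (inj₁ refl) (inj₂ refl) _   x≢z = contradiction refl x≢z
other-of-two (inj₂ refl) (inj₂ refl) _           x≢y _   = contradiction refl x≢y

module _ {n k} {G : Graph n} {q : Fin n → Fin k} {v : Fin n} {a : Fin k} where

  private
    q′ : Fin n → Fin k
    q′ = updateAt q v (const a)

    unchanged : ∀ {z} → z ≢ v → q′ z ≡ q z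
    unchanged {z} = updateAt-minimal z v q

    same-colour : ∀ {z z′} → z ≢ v → z′ ≢ v → q′ z ≡ q′ z′ → q z ≡ q z′
    same-colour z≢v z′≢v e = trans (sym (unchanged z≢v)) (trans e (unchanged z′≢v))

  updateAt-proper : Proper G q → ¬ AppearsAt G q v a → Proper G (updateAt q v (const a))
  updateAt-proper proper a∉N[v] = proper′
    where
    proper-at-v : ∀ {z} → Adj G v z → q′ v ≢ q′ z
    proper-at-v {z} v~z qv′≡qz′ = a∉N[v] (inj₂ (z , v~z , (begin
      q z  ≡⟨ unchanged (≢-sym (adj-≢ G v~z)) ⟨
      q′ z ≡⟨ qv′≡qz′ ⟨
      q′ v ≡⟨ updateAt-updates v q ⟩
      a    ∎)))
      where open ≡-Reasoning

    proper′ : Proper G q′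
    proper′ z₁ z₂ z₁~z₂ with z₁ ≟ v | z₂ ≟ v
    ... | yes refl | _        = proper-at-v z₁~z₂
    ... | _        | yes refl = ≢-sym (proper-at-v (adj-sym G z₁~z₂))
    ... | no z₁≢v  | no z₂≢v  = proper z₁ z₂ z₁~z₂ ∘ same-colour z₁≢v z₂≢v

  -- On a 2-coloured arc, u and w share a colour and x, y get the new colour a of v.
  arc-dangerous : ∀ {b₁ b₂} → Proper G (updateAt q v (const a)) →
                  Arc G (λ z → updateAt q v (const a) z ≡ b₁ ⊎ updateAt q v (const a) z ≡ b₂) v →
                  Dangerous G q v a
  arc-dangerous proper′ arc =
    u , w , v~u , v~w , u≢w , same-colour u≢v w≢v q′u≡q′w ,
    (x , u~x , x≢v , coloured-a x≢v q′x≡q′v) , (y , w~y , y≢v , coloured-a y≢v q′y≡q′v)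
    where
    open Arc arc
    u≢v = ≢-sym (adj-≢ G v~u)
    w≢v = ≢-sym (adj-≢ G v~w)
    q′u≡q′w = other-of-two Pv Pu Pw (proper′ _ _ v~u) (proper′ _ _ v~w)
    q′x≡q′v = other-of-two Pu Px Pv (proper′ _ _ u~x) (≢-sym (proper′ _ _ v~u))
    q′y≡q′v = other-of-two Pw Py Pv (proper′ _ _ w~y) (≢-sym (proper′ _ _ v~w))

    coloured-a : ∀ {z} → z ≢ v → q′ z ≡ q′ v → q z ≡ a
    coloured-a z≢v e = trans (sym (unchanged z≢v)) (trans e (updateAt-updates v q))

  updateAt-acyclic : Acyclic G q → Proper G (updateAt q v (const a)) → ¬ Dangerous G q v a →
                     Acyclic G (updateAt q v (const a))
  updateAt-acyclic acyclic proper′ safe b₁ b₂ C with any? (λ m → CycleIn.f C m ≟ v)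
  ... | yes (m , fm≡v) = safe (arc-dangerous proper′ (subst (Arc G _) fm≡v (cycle-arc C m)))
  ... | no v∉C         = acyclic b₁ b₂ (record { CycleIn C ; inside = λ m →
          subst (λ z → z ≡ b₁ ⊎ z ≡ b₂) (unchanged (v∉C ∘ (m ,_))) (inside m) })
    where open CycleIn C

module ColourWeights {n k} (G : Graph n) (q : Fin n → Fin k) (v : Fin n) where

  Blocked : Fin k → Set
  Blocked a = AppearsAt G q v a ⊎ Dangerous G q v a

  SharesColour : Fin n → Set
  SharesColour u = ∃ λ w → Adj G v w × w ≢ u × q w ≡ q u

  sharesColour? : ∀ u → Dec (SharesColour u)
  sharesColour? u = any? λ w → T? (adj G v w) ×-dec ¬? (w ≟ u) ×-dec (q w ≟ q u)

  otherNeighbour : Fin n → Fin n → Bool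
  otherNeighbour u x = adj G u x ∧ not (does (v ≟ x))

  othersColoured : Fin n → Fin k → ℕ
  othersColoured u a = ∑[ x < n ] (𝟙 (otherNeighbour u x) * δ (q x) a)

  charge : Fin n → Fin k → ℕ
  charge u a = if does (sharesColour? u) then δ (q u) a + othersColoured u a else 2 * δ (q u) a

  term : Fin n → Fin k → ℕ
  term u a = 𝟙 (adj G v u) * charge u a

  weight : Fin k → ℕ
  weight a = ∑[ u < n ] term u a + 2 * δ (q v) a

  term-adj : ∀ {u a} → Adj G v u → term u a ≡ charge u a
  term-adj {u} {a} v~u = trans (cong (_* charge u a) (𝟙-T v~u)) (*-identityˡ _)

  charge-shared : ∀ {u a} → SharesColour u → charge u a ≡ δ (q u) a + othersColoured u a
  charge-shared {u} {a} s =
    cong (λ b → if b then δ (q u) a + othersColoured u a else 2 * δ (q u) a) (dec-true (sharesColour? u) s)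

  charge-alone : ∀ {u a} → ¬ SharesColour u → charge u a ≡ 2 * δ (q u) a
  charge-alone {u} {a} ¬s =
    cong (λ b → if b then δ (q u) a + othersColoured u a else 2 * δ (q u) a) (dec-false (sharesColour? u) ¬s)

  neighbour-split : ∀ {u} → Adj G u v → ∀ x → δ v x + 𝟙 (otherNeighbour u x) ≡ 𝟙 (adj G u x)
  neighbour-split {u} u~v x with v ≟ x
  ... | yes refl = trans (cong (λ b → 1 + 𝟙 b) (∧-zeroʳ (adj G u v))) (sym (𝟙-T u~v))
  ... | no _     = cong 𝟙 (∧-identityʳ (adj G u x))

  otherNeighbour-count : ∀ {u} → Adj G u v → suc (∑[ x < n ] 𝟙 (otherNeighbour u x)) ≡ deg G u
  otherNeighbour-count {u} u~v = begin
    suc (∑[ x < n ] 𝟙 (otherNeighbour u x))               ≡⟨ cong (_+ ∑[ x < n ] 𝟙 (otherNeighbour u x)) (∑-δ v) ⟨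
    ∑[ x < n ] δ v x + ∑[ x < n ] 𝟙 (otherNeighbour u x)  ≡⟨ ∑-distrib-+ (δ v) (𝟙 ∘ otherNeighbour u) ⟨
    ∑[ x < n ] (δ v x + 𝟙 (otherNeighbour u x))           ≡⟨ sum-cong-≗ (neighbour-split u~v) ⟩
    ∑[ x < n ] 𝟙 (adj G u x)                              ≡⟨ deg≡∑ G u ⟨
    deg G u                                               ∎
    where open ≡-Reasoning

  charge-total : 2 ≤ Δ G → ∀ {u} → Adj G v u → ∑[ a < k ] charge u a ≤ Δ G
  charge-total 2≤Δ {u} v~u = by-sharing (sharesColour? u)
    where
    open ℕ.≤-Reasoning
    by-sharing : Dec (SharesColour u) → ∑[ a < k ] charge u a ≤ Δ G
    by-sharing (yes s) = begin
      ∑[ a < k ] charge u a                                 ≡⟨ sum-cong-≗ {k} (λ _ → charge-shared s) ⟩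
      ∑[ a < k ] (δ (q u) a + othersColoured u a)           ≡⟨ ∑-distrib-+ (δ (q u)) (othersColoured u) ⟩
      ∑[ a < k ] δ (q u) a + ∑[ a < k ] othersColoured u a  ≡⟨ cong₂ _+_ (∑-δ (q u)) (∑-fibres (𝟙 ∘ otherNeighbour u) q) ⟩
      suc (∑[ x < n ] 𝟙 (otherNeighbour u x))               ≡⟨ otherNeighbour-count (adj-sym G v~u) ⟩
      deg G u                                               ≤⟨ deg≤Δ G u ⟩
      Δ G                                                   ∎
    by-sharing (no ¬s) = begin
      ∑[ a < k ] charge u a         ≡⟨ sum-cong-≗ {k} (λ _ → charge-alone ¬s) ⟩
      ∑[ a < k ] (2 * δ (q u) a)    ≡⟨ *-distribˡ-sum 2 (δ (q u)) ⟨
      2 * ∑[ a < k ] δ (q u) a      ≡⟨ cong (2 *_) (∑-δ (q u)) ⟩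
      2                             ≤⟨ 2≤Δ ⟩
      Δ G                           ∎

  weight-total : 2 ≤ Δ G → ∑[ a < k ] weight a ≤ Δ G * Δ G + 2
  weight-total 2≤Δ = begin
    ∑[ a < k ] weight a                                          ≡⟨ ∑-distrib-+ (λ a → ∑[ u < n ] term u a) (λ a → 2 * δ (q v) a) ⟩
    ∑[ a < k ] ∑[ u < n ] term u a + ∑[ a < k ] (2 * δ (q v) a)  ≡⟨ cong₂ _+_ (∑-comm (λ a u → term u a)) own ⟩
    ∑[ u < n ] ∑[ a < k ] term u a + 2                           ≤⟨ +-monoˡ-≤ 2 (∑-mono-≤ term-total) ⟩
    ∑[ u < n ] (𝟙 (adj G v u) * Δ G) + 2                         ≡⟨ cong (_+ 2) neighbours ⟩
    deg G v * Δ G + 2                                            ≤⟨ +-monoˡ-≤ 2 (*-monoˡ-≤ (Δ G) (deg≤Δ G v)) ⟩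
    Δ G * Δ G + 2                                                ∎
    where
    open ℕ.≤-Reasoning
    own : ∑[ a < k ] (2 * δ (q v) a) ≡ 2
    own = trans (sym (*-distribˡ-sum 2 (δ (q v)))) (cong (2 *_) (∑-δ (q v)))
    term-total : ∀ u → ∑[ a < k ] term u a ≤ 𝟙 (adj G v u) * Δ G
    term-total u = ≤-trans (≤-reflexive (sym (*-distribˡ-sum (𝟙 (adj G v u)) (charge u))))
                           (𝟙*-mono-≤ (adj G v u) (charge-total 2≤Δ))
    neighbours : ∑[ u < n ] (𝟙 (adj G v u) * Δ G) ≡ deg G v * Δ G
    neighbours = trans (sym (*-distribʳ-sum (Δ G) (𝟙 ∘ adj G v))) (cong (_* Δ G) (sym (deg≡∑ G v)))

  otherNeighbour-𝟙 : ∀ {u x} → Adj G u x → x ≢ v → 𝟙 (otherNeighbour u x) ≡ 1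
  otherNeighbour-𝟙 {u} {x} u~x x≢v =
    trans (cong (λ b → 𝟙 (adj G u x ∧ not b)) (dec-false (v ≟ x) (≢-sym x≢v)))
          (trans (cong 𝟙 (∧-identityʳ (adj G u x))) (𝟙-T u~x))

  othersColoured-pos : ∀ {u a} → OtherNeighbourColoured G q u v a → 1 ≤ othersColoured u a
  othersColoured-pos {u} {a} (x , u~x , x≢v , qx≡a) = begin
    1                                   ≡⟨ cong₂ _*_ (otherNeighbour-𝟙 u~x x≢v) (δ-≡ qx≡a) ⟨
    𝟙 (otherNeighbour u x) * δ (q x) a  ≤⟨ ≤-∑ (λ x → 𝟙 (otherNeighbour u x) * δ (q x) a) x ⟩
    othersColoured u a                  ∎
    where open ℕ.≤-Reasoning

  term-own-shared : ∀ {u a} → Adj G v u → SharesColour u → q u ≡ a → 1 ≤ term u a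
  term-own-shared {u} {a} v~u s qu≡a = begin
    1                                  ≡⟨ δ-≡ qu≡a ⟨
    δ (q u) a                          ≤⟨ m≤m+n _ _ ⟩
    δ (q u) a + othersColoured u a     ≡⟨ trans (term-adj v~u) (charge-shared s) ⟨
    term u a                           ∎
    where open ℕ.≤-Reasoning

  term-beyond-shared : ∀ {u a} → Adj G v u → SharesColour u → OtherNeighbourColoured G q u v a → 1 ≤ term u a
  term-beyond-shared {u} {a} v~u s beyond = begin
    1                                  ≤⟨ othersColoured-pos beyond ⟩
    othersColoured u a                 ≤⟨ m≤n+m _ _ ⟩
    δ (q u) a + othersColoured u a     ≡⟨ trans (term-adj v~u) (charge-shared s) ⟨
    term u a                           ∎
    where open ℕ.≤-Reasoning

  one-term-weight : ∀ {u a} → 2 ≤ term u a → 2 ≤ weight a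
  one-term-weight {u} {a} 2≤term = ≤-trans 2≤term (≤-trans (≤-∑ (λ u → term u a) u) (m≤m+n _ _))

  two-terms-weight : ∀ {u w a} → u ≢ w → 1 ≤ term u a → 1 ≤ term w a → 2 ≤ weight a
  two-terms-weight {u} {w} {a} u≢w 1≤u 1≤w =
    ≤-trans (+-mono-≤ 1≤u 1≤w) (≤-trans (+-≤-∑ (λ u → term u a) u≢w) (m≤m+n _ _))

  blocked-weight : ∀ {a} → Blocked a → 2 ≤ weight a
  blocked-weight {a} (inj₁ (inj₁ qv≡a)) =
    ≤-trans (≤-reflexive (cong (2 *_) (sym (δ-≡ qv≡a)))) (m≤n+m _ (∑[ u < n ] term u a))
  blocked-weight {a} (inj₁ (inj₂ (u , v~u , qu≡a))) = by-sharing (sharesColour? u)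
    where
    by-sharing : Dec (SharesColour u) → 2 ≤ weight a
    by-sharing (yes s@(w , v~w , w≢u , qw≡qu)) =
      two-terms-weight (≢-sym w≢u) (term-own-shared v~u s qu≡a)
                       (term-own-shared v~w (u , v~u , ≢-sym w≢u , sym qw≡qu) (trans qw≡qu qu≡a))
    by-sharing (no ¬s) =
      one-term-weight (≤-reflexive (sym (trans (term-adj v~u) (trans (charge-alone ¬s) (cong (2 *_) (δ-≡ qu≡a))))))
  blocked-weight (inj₂ (u , w , v~u , v~w , u≢w , qu≡qw , beyond-u , beyond-w)) =
    two-terms-weight u≢w (term-beyond-shared v~u (w , v~w , ≢-sym u≢w , sym qu≡qw) beyond-u)
                         (term-beyond-shared v~w (u , v~u , u≢w , qu≡qw) beyond-w)

  all-blocked-bound : 2 ≤ Δ G → (∀ a → Blocked a) → 2 * k ≤ Δ G * Δ G + 2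
  all-blocked-bound 2≤Δ blocked = begin
    2 * k                ≡⟨ trans (∑-const k 2) (*-comm k 2) ⟨
    ∑[ a < k ] 2         ≤⟨ ∑-mono-≤ (blocked-weight ∘ blocked) ⟩
    ∑[ a < k ] weight a  ≤⟨ weight-total 2≤Δ ⟩
    Δ G * Δ G + 2        ∎
    where open ℕ.≤-Reasoning

  blocked? : ∀ a → Dec (Blocked a)
  blocked? a = appearsAt? G q v a ⊎-dec dangerous? G q v a

fresh-colour : ∀ {n k} {G : Graph n} → 2 ≤ Δ G → Δ G * Δ G + 2 < 2 * k →
               ∀ (q : Fin n → Fin k) v → ∃ (Fresh G q v)
fresh-colour {k = k} {G} 2≤Δ few-colours q v
  with ¬∀⟶∃¬ k Blocked blocked? (<⇒≱ few-colours ∘ all-blocked-bound 2≤Δ)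
  where open ColourWeights G q v
... | a , unblocked = a , unblocked ∘ inj₁ , unblocked ∘ inj₂

module Recolouring {n k} (G : Graph n) (i : Fin k) (fresh : ∀ (q : Fin n → Fin k) v → ∃ (Fresh G q v)) where

  recolourAt : Fin n → (Fin n → Fin k) → Fin n → Fin k
  recolourAt v q with q v ≟ i | fresh q v
  ... | yes _ | a , _ = updateAt q v (const a)
  ... | no _  | _     = q

  recolourAll : List (Fin n) → (Fin n → Fin k) → Fin n → Fin k
  recolourAll vs q = foldr recolourAt q vs

  ProperAcyclic : (Fin n → Fin k) → Set
  ProperAcyclic q = Proper G q × Acyclic G q

  recolourAt-properAcyclic : ∀ v {q} → ProperAcyclic q → ProperAcyclic (recolourAt v q)
  recolourAt-properAcyclic v {q} (proper , acyclic) with q v ≟ i | fresh q v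
  ... | no _  | _                   = proper , acyclic
  ... | yes _ | a , a∉N[v] , safe = proper′ , updateAt-acyclic acyclic proper′ safe
    where
    proper′ : Proper G (updateAt q v (const a))
    proper′ = updateAt-proper {G = G} {q = q} proper a∉N[v]

  recolourAt-stable : ∀ v {q z} → q z ≢ i → recolourAt v q z ≡ q z
  recolourAt-stable v {q} {z} qz≢i with q v ≟ i
  ... | no _     = refl
  ... | yes qv≡i = updateAt-minimal z v q (λ { refl → qz≢i qv≡i })

  recolourAt-clears : ∀ v q → recolourAt v q v ≢ i
  recolourAt-clears v q with q v ≟ i | fresh q v
  ... | no qv≢i  | _              = qv≢i
  ... | yes qv≡i | a , a∉N[v] , _ = λ a≡i → a∉N[v] (inj₁ (begin
    q v                             ≡⟨ qv≡i ⟩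
    i                               ≡⟨ a≡i ⟨
    updateAt q v (const a) v        ≡⟨ updateAt-updates v q ⟩
    a                               ∎))
    where open ≡-Reasoning

  recolourAll-properAcyclic : ∀ vs {q} → ProperAcyclic q → ProperAcyclic (recolourAll vs q)
  recolourAll-properAcyclic []       pa = pa
  recolourAll-properAcyclic (v ∷ vs) pa = recolourAt-properAcyclic v (recolourAll-properAcyclic vs pa)

  recolourAll-stable : ∀ vs {q z} → q z ≢ i → recolourAll vs q z ≡ q z
  recolourAll-stable []       _    = refl
  recolourAll-stable (v ∷ vs) {q} {z} qz≢i =
    trans (recolourAt-stable v {recolourAll vs q} (subst (_≢ i) (sym unchanged) qz≢i)) unchanged
    where
    unchanged : recolourAll vs q z ≡ q z
    unchanged = recolourAll-stable vs qz≢i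

  recolourAll-clears : ∀ {vs z} q → z ∈ vs → recolourAll vs q z ≢ i
  recolourAll-clears {v ∷ vs}     q (here refl)  = recolourAt-clears v (recolourAll vs q)
  recolourAll-clears {v ∷ vs} {z} q (there z∈vs) =
    subst (_≢ i) (sym (recolourAt-stable v {recolourAll vs q} {z} cleared)) cleared
    where cleared = recolourAll-clears q z∈vs

  acyclicRecolorable : ∀ {c} → Proper G c → Acyclic G c → AcyclicRecolorable G c
  acyclicRecolorable {c} proper acyclic =
    acyclic , i , c′ , (no-b-vertex , (λ _ → recolourAll-stable (allFin n)) , avoids-N[v]) , acyclic′
    where
    c′ = recolourAll (allFin n) c
    properAcyclic′ : ProperAcyclic c′
    properAcyclic′ = recolourAll-properAcyclic (allFin n) (proper , acyclic)
    proper′ = proj₁ properAcyclic′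
    acyclic′ = proj₂ properAcyclic′

    no-b-vertex : ∀ v → ¬ (c v ≡ i × IsBVertex G c v)
    no-b-vertex v (_ , b-vertex) with fresh c v
    ... | a , a∉N[v] , _ = a∉N[v] (b-vertex a)

    avoids-N[v] : ∀ v → c v ≡ i → ¬ AppearsAt G c v (c′ v)
    avoids-N[v] v cv≡i (inj₁ cv≡c′v) = recolourAll-clears c (∈-allFin v) (trans (sym cv≡c′v) cv≡i)
    avoids-N[v] v cv≡i (inj₂ (u , v~u , cu≡c′v)) =
      proper′ u v (adj-sym G v~u) (trans (recolourAll-stable (allFin n) cu≢i) cu≡c′v)
      where cu≢i = λ cu≡i → proper v u v~u (trans cv≡i (sym cu≡i))

corollary6 : ∀ (n : ℕ) (G : Graph n) → 2 ≤ Δ G →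
             ∀ (k : ℕ) (c : Fin n → Fin k) → IsAcyclicBColoring G c →
             2 * k ≤ Δ G * Δ G + 2
corollary6 n G 2≤Δ zero    c _ = z≤n
corollary6 n G 2≤Δ (suc k) c ((proper , _) , acyclic , irreducible) with 2 * suc k ≤? Δ G * Δ G + 2
... | yes bound = bound
... | no ¬bound = contradiction (acyclicRecolorable proper acyclic) irreducible
  where open Recolouring G zero (fresh-colour {G = G} 2≤Δ (≰⇒> ¬bound))
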